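{- Let $\mathcal{T}$ be the set of tokens $(M,E_?,E_!,f)$ where $M\in\{0,1\}^*$, $E_?,E_!\in(\{0,1\}^*)^*$ and $f:\mathcal{N}\to\{0,1\}^*$ is a function equal to the empty word $\epsilon$ for all but finitely many names. Consider the following partial injections of $\mathcal{T}$ (the concatenation of stacks is written $\cdot$, $0,1\in\{0,1\}$ are the bits, and $f[\alpha\mapsto\sigma]$ agrees with $f$ except that it sends $\alpha$ to $\sigma$): - $\mathfrak{p}:(M,E_?,E_!,f)\mapsto(0\cdot M,E_?,E_!,f)$ and $\mathfrak{q}:(M,E_?,E_!,f)\mapsto(1\cdot M,E_?,E_!,f)$; - $\mathfrak{r}_?:(M,\sigma\cdot E_?,E_!,f)\mapsto(M,(0\cdot\sigma)\cdot E_?,E_!,f)$ and $\mathfrak{s}_?:(M,\sigma\cdot E_?,E_!,f)\mapsto(M,(1\cdot\sigma)\cdot E_?,E_!,f)$; - $\mathfrak{d}^?_\alpha:(M,E_?,E_!,f)\mapsto(M,\epsilon\cdot E_?,f(\alpha)\cdot E_!,f)$; - $\mathfrak{u}_\alpha:(M,E_?,E_!,f)\mapsto(M,E_?,E_!,f[\alpha\mapsto 0\cdot f(\alpha)])$ and $\mathfrak{v}_\alpha:(M,E_?,E_!,f)\mapsto(M,E_?,E_!,f[\alpha\mapsto 1\cdot f(\alpha)])$; - $\mathfrak{e}_\alpha$: the identity restricted to tokens with $f(\alpha)=\epsilon$; - $\mathfrak{r}_!,\mathfrak{s}_!,\mathfrak{d}^!_\alpha$: the duals of $\mathfrak{r}_?,\mathfrak{s}_?,\mathfrak{d}^?_\alpha$,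 obtained by exchanging the roles of the stacks $E_?$ and $E_!$ (e.g. $\mathfrak{d}^!_\alpha:(M,E_?,E_!,f)\mapsto(M,f(\alpha)\cdot E_?,\epsilon\cdot E_!,f)$). Let $\mathcal{M}$ be the smallest set of partial injections of $\mathcal{T}$ containing these operations and closed under composition and inversion. Then $\mathcal{M}$, with composition as product, inverse as star, the identity as $1$ and the nowhere-defined function as $0$, is an inverse monoid with zero, and under the interpretation $p\mapsto\mathfrak{p}$, $q\mapsto\mathfrak{q}$, $r_t\mapsto\mathfrak{r}_t$, $s_t\mapsto\mathfrak{s}_t$, $d^t_\alpha\mapsto\mathfrak{d}^t_\alpha$, $u_\alpha\mapsto\mathfrak{u}_\alpha$, $v_\alpha\mapsto\mathfrak{v}_\alpha$, $e_\alpha\mapsto\mathfrak{e}_\alpha$ it satisfies all the following relations, for all names $\alpha\neq\beta$ and $t,t'\in\{?,!\}$ with $t\neq t'$: (i) $p\perp\!\!\!\perp q$; (ii) $u_\alpha\perp\!\!\!\perp v_\alpha$; (iii) $e_\alpha e_\alpha=e_\alpha$; (iv) each of $r_!,s_!$ commutes with each of $r_?^*,s_?^*$; (v) each of $u_\alpha,v_\alpha,e_\alpha$ commutes with each element of $\{p,q,r_?,s_?,r_!,s_!\}\cup\{d^?_\beta,d^!_\beta,u_\beta,v_\beta,e_\beta\}$ and with its star; (vi) $(d^t_\alpha)^*r_{t'}=u_\alpha(d^t_\alpha)^*u_\alpha^*$; (vii) $(d^t_\alpha)^*s_{t'}=v_\alpha(d^t_\alpha)^*v_\alpha^*$; (viii)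 $(d^!_\alpha)^*d^?_\beta=e_\alpha e_\beta$.
   Context: $\mathcal{N}$ is a fixed countable set of names. An inverse monoid with zero is a monoid with an operation $x\mapsto x^*$ and an element $0$ such that $(uv)^*=v^*u^*$, $(u^*)^*=u$, $uu^*u=u$, $uu^*vv^*=vv^*uu^*$ and $u0=0u=0$. Two elements $a,b$ are fully orthogonal, written $a\perp\!\!\!\perp b$, when $aa^*bb^*=0$ and $a^*a=b^*b=1$. -}

module Defs where

open import Level using (Level; _⊔_) renaming (suc to lsuc; zero to lzero)
open import Data.Bool using (Bool; true; false)
open import Data.Nat using (ℕ)
import Data.Nat as ℕ
open import Data.List using (List; []; _∷_)
open import Data.List.Membership.Propositional using (_∈_; _∉_)
open import Data.List.Relation.Unary.Any using (here; there)
open import Data.Maybe using (Maybe; just; nothing)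
open import Data.Product using (Σ; ∃; _×_; _,_; proj₁; proj₂)
open import Data.Empty using (⊥)
open import Relation.Nullary using (yes; no; ¬_)
open import Relation.Binary.Core using (Rel)
open import Relation.Binary.Definitions using (DecidableEquality)
open import Relation.Binary.PropositionalEquality using (_≡_; _≢_; refl; cong)
open import Function.Definitions using (Injective)
open import Algebra.Structures using (IsMonoid)

record IsInverseMonoidWithZero {a ℓ : Level} {A : Set a} (_≈_ : Rel A ℓ)
         (_∙_ : A → A → A) (_⋆ : A → A) (1# 0# : A) : Set (a ⊔ ℓ) where
  field
    isMonoid   : IsMonoid _≈_ _∙_ 1#
    ⋆-cong     : ∀ {x y} → x ≈ y → (x ⋆) ≈ (y ⋆)
    ⋆-anti     : ∀ u v → ((u ∙ v) ⋆) ≈ ((v ⋆) ∙ (u ⋆))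
    ⋆-invol    : ∀ u → ((u ⋆) ⋆) ≈ u
    regular    : ∀ u → ((u ∙ (u ⋆)) ∙ u) ≈ u
    idem-comm  : ∀ u v → ((u ∙ (u ⋆)) ∙ (v ∙ (v ⋆))) ≈ ((v ∙ (v ⋆)) ∙ (u ∙ (u ⋆)))
    zeroʳ      : ∀ u → (u ∙ 0#) ≈ 0#
    zeroˡ      : ∀ u → (0# ∙ u) ≈ 0#

-- The token machine, over a countable set of names
-- (countable = admits an injection into ℕ)

data Tag : Set where
  t? t! : Tag

dual : Tag → Tag
dual t? = t!
dual t! = t?

module Tokens (Name : Set) (ι : Name → ℕ) (ι-inj : Injective _≡_ _≡_ ι) where

  _≟N_ : DecidableEquality Name
  a ≟N b with ι a ℕ.≟ ι b
  ... | yes e = yes (ι-inj e)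
  ... | no ne = no (λ e → ne (cong ι e))

  Word : Set
  Word = List Bool

  FinSupp : (Name → Word) → Set
  FinSupp g = ∃ λ (S : List Name) → ∀ α → α ∉ S → g α ≡ []

  record Token : Set where
    field
      M   : Word
      E?  : List Word
      E!  : List Word
      f   : Name → Word
      fin : FinSupp f
  open Token public

  -- equality of tokens (f compared pointwise; the support witness is irrelevant)
  _≈ₜ_ : Token → Token → Set
  x ≈ₜ y = (M x ≡ M y) × (E? x ≡ E? y) × (E! x ≡ E! y) × (∀ α → f x α ≡ f y α)

  update : (Name → Word) → Name → Word → Name → Word
  update g α σ β with β ≟N α
  ... | yes _ = σ
  ... | no  _ = g β

  update-fin : ∀ g α σ → FinSupp g → FinSupp (update g α σ)
  update-fin g α σ (S , h) = (α ∷ S) , λ β β∉ → go β β∉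
    where
    go : ∀ β → β ∉ (α ∷ S) → update g α σ β ≡ []
    go β β∉ with β ≟N α
    ... | yes e = Data.Empty.⊥-elim (β∉ (here e))
      where import Data.Empty
    ... | no _  = h β (λ m → β∉ (there m))

  setF : Token → Name → Word → Token
  setF x α σ = record x { f = update (f x) α σ ; fin = update-fin (f x) α σ (fin x) }

  stack : Tag → Token → List Word
  stack t? x = E? x
  stack t! x = E! x

  setStack : Tag → List Word → Token → Token
  setStack t? E x = record x { E? = E }
  setStack t! E x = record x { E! = E }

  pushM : Bool → Token → Maybe Token
  pushM b x = just (record x { M = b ∷ M x })

  pushTop : Bool → Tag → Token → Maybe Token
  pushTop b t x with stack t x
  ... | []     = nothing
  ... | σ ∷ E  = just (setStack t ((b ∷ σ) ∷ E) x)

  dmap : Tag → Name → Token → Maybe Token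
  dmap t α x = just (setStack t ([] ∷ stack t x)
                      (setStack (dual t) (f x α ∷ stack (dual t) x) x))

  pushF : Bool → Name → Token → Maybe Token
  pushF b α x = just (setF x α (b ∷ f x α))

  emap : Name → Token → Maybe Token
  emap α x with f x α
  ... | []    = just x
  ... | _ ∷ _ = nothing

  -- partial injections, represented by their graphs
  PI : Set₁
  PI = Token → Token → Set

  Graph : (Token → Maybe Token) → PI
  Graph g x y = Σ Token λ z → (g x ≡ just z) × (z ≈ₜ y)

  -- composition: (R ∘ S) applies S first, then R  (uv = u ∘ v)
  _∘_ : PI → PI → PI
  (R ∘ S) x z = Σ Token λ y → S x y × R y z
  infixl 7 _∘_

  _ᵒ : PI → PI
  (R ᵒ) x y = R y x
  infix 8 _ᵒ

  Id : PI
  Id x y = x ≈ₜ y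

  Zero : PI
  Zero x y = ⊥

  _≐_ : PI → PI → Set
  R ≐ S = ∀ x y → (R x y → S x y) × (S x y → R x y)
  infix 4 _≐_

  IsPartialInjection : PI → Set
  IsPartialInjection R =
      (∀ {x x' y y'} → x ≈ₜ x' → y ≈ₜ y' → R x y → R x' y')
    × (∀ {x y y'} → R x y → R x y' → y ≈ₜ y')
    × (∀ {x x' y} → R x y → R x' y → x ≈ₜ x')

  data Op : Set where
    p q : Op
    r s : Tag → Op
    d   : Tag → Name → Op
    u v e : Name → Op

  ⟦_⟧ : Op → PI
  ⟦ p ⟧     = Graph (pushM false)
  ⟦ q ⟧     = Graph (pushM true)
  ⟦ r t ⟧   = Graph (pushTop false t)
  ⟦ s t ⟧   = Graph (pushTop true t)
  ⟦ d t α ⟧ = Graph (dmap t α)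
  ⟦ u α ⟧   = Graph (pushF false α)
  ⟦ v α ⟧   = Graph (pushF true α)
  ⟦ e α ⟧   = Graph (emap α)

  -- 𝓜 : the smallest set of partial maps (as extensional objects) containing
  -- the generators and closed under composition and inversion
  data InM : PI → Set₁ where
    gen  : ∀ o → InM ⟦ o ⟧
    comp : ∀ {R S} → InM R → InM S → InM (R ∘ S)
    inv  : ∀ {R} → InM R → InM (R ᵒ)
    ext  : ∀ {R S} → InM R → R ≐ S → InM S

  Carrier : Set₁
  Carrier = Σ PI InM

  _≈ᴹ_ : Carrier → Carrier → Set
  a ≈ᴹ b = proj₁ a ≐ proj₁ b

  _·ᴹ_ : Carrier → Carrier → Carrier
  (R , mR) ·ᴹ (S , mS) = (R ∘ S) , comp mR mS

  _⋆ᴹ : Carrier → Carrier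
  (R , mR) ⋆ᴹ = (R ᵒ) , inv mR

  Commute : PI → PI → Set
  Commute R S = R ∘ S ≐ S ∘ R

  _⊥⊥_ : PI → PI → Set
  a ⊥⊥ b = ((a ∘ a ᵒ) ∘ (b ∘ b ᵒ) ≐ Zero) × (a ᵒ ∘ a ≐ Id) × (b ᵒ ∘ b ≐ Id)

-- Every generator is the graph of an injective partial map on tokens, and all of them except d
-- act on a single component of a token (the word M, one of the two stacks, or one register
-- f(α)) through an injective partial map of that component.  Graphs of partial injections are
-- closed under composition and inversion, and they form an inverse monoid because the
-- idempotents R Rᵒ are partial identities (on the range of R), and partial identities commute.
-- Pushing different bits onto the same component gives total maps with disjoint ranges, whence
-- (i) and (ii); an operation acting on one component commutes with every partial injection that
-- neither reads nor changes that component, whence (iv) and (v).  The remaining relations are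
-- computations on the components of tokens.
module Submission where

open import Level using (0ℓ) renaming (suc to lsuc)
open import Data.Bool using (Bool; true; false)
open import Data.Nat using (ℕ)
open import Data.List using (List; []; _∷_)
open import Data.List.Properties using (∷-injectiveˡ; ∷-injectiveʳ)
open import Data.List.Membership.Propositional using (_∈_)
open import Data.List.Relation.Unary.All using (All; []; _∷_; lookup)
open import Data.Maybe using (Maybe; just; nothing; map)
open import Data.Maybe.Properties using (just-injective)
open import Data.Product using (Σ; ∃; ∃₂; _×_; _,_; proj₁; proj₂)
open import Data.Empty using (⊥; ⊥-elim)
open import Relation.Nullary using (yes; no)
open import Relation.Binary.Bundles using (Setoid)
open import Relation.Binary.Definitions using (_Respects_)
open import Relation.Binary.PropositionalEquality
  using (_≡_; _≢_; refl; sym; trans; cong; cong₂; ≢-sym)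
import Relation.Binary.Reasoning.Setoid as SetoidReasoning
open import Function.Definitions using (Injective; Congruent)
open import Defs

module TokenMachine (Name : Set) (ι : Name → ℕ) (ι-inj : Injective _≡_ _≡_ ι) where

  open Tokens Name ι ι-inj

  -- Token equality and function update

  -- _≈ₜ_ unfolds to componentwise equalities, from which Agda cannot recover the tokens
  -- themselves: hence the explicit token arguments and eta-expansions throughout.
  ≈ₜ-refl : ∀ x → x ≈ₜ x
  ≈ₜ-refl x = refl , refl , refl , λ _ → refl

  ≈ₜ-setoid : Setoid 0ℓ 0ℓ
  ≈ₜ-setoid = record
    { Carrier       = Token
    ; _≈_           = _≈ₜ_
    ; isEquivalence = record
      { refl  = λ {x} → ≈ₜ-refl x
      ; sym   = λ (m , e? , e! , g) → sym m , sym e? , sym e! , λ β → sym (g β)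
      ; trans = λ (m , e? , e! , g) (m' , e?' , e!' , g') →
                  trans m m' , trans e? e?' , trans e! e!' , λ β → trans (g β) (g' β)
      }
    }

  open Setoid ≈ₜ-setoid using () renaming (sym to ≈ₜ-sym; trans to ≈ₜ-trans)
  module ≈ₜ-Reasoning = SetoidReasoning ≈ₜ-setoid

  update-≡ : ∀ g α σ → update g α σ α ≡ σ
  update-≡ g α σ with α ≟N α
  ... | yes _   = refl
  ... | no α≢α = ⊥-elim (α≢α refl)

  update-≢ : ∀ g α σ {β} → β ≢ α → update g α σ β ≡ g β
  update-≢ g α σ {β} β≢α with β ≟N α
  ... | yes β≡α = ⊥-elim (β≢α β≡α)
  ... | no _    = refl

  update-cong : ∀ {g h} α {σ τ} → (∀ β → g β ≡ h β) → σ ≡ τ →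
                ∀ β → update g α σ β ≡ update h α τ β
  update-cong α g≗h σ≡τ β with β ≟N α
  ... | yes _ = σ≡τ
  ... | no _  = g≗h β

  update-id : ∀ g α β → update g α (g α) β ≡ g β
  update-id g α β with β ≟N α
  ... | yes refl = refl
  ... | no _     = refl

  update-update : ∀ g α σ τ β → update (update g α σ) α τ β ≡ update g α τ β
  update-update g α σ τ β with β ≟N α
  ... | yes _   = refl
  ... | no β≢α = update-≢ g α σ β≢α

  update-comm : ∀ g {α β} σ τ → α ≢ β →
                ∀ γ → update (update g β τ) α σ γ ≡ update (update g α σ) β τ γ
  update-comm g {α} {β} σ τ α≢β γ with γ ≟N α | γ ≟N β
  ... | yes refl | yes refl = ⊥-elim (α≢β refl)
  ... | yes refl | no _     = sym (update-≡ g α σ)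
  ... | no _     | yes refl = update-≡ g β τ
  ... | no γ≢α   | no γ≢β   = trans (update-≢ g β τ γ≢β) (sym (update-≢ g α σ γ≢α))

  -- Calculus of partial injections

  ≐-refl : ∀ {R} → R ≐ R
  ≐-refl _ _ = (λ h → h) , (λ h → h)

  ≐-sym : ∀ {R S} → R ≐ S → S ≐ R
  ≐-sym R≐S x y = proj₂ (R≐S x y) , proj₁ (R≐S x y)

  ≐-trans : ∀ {R S T} → R ≐ S → S ≐ T → R ≐ T
  ≐-trans R≐S S≐T x y = (λ h → proj₁ (S≐T x y) (proj₁ (R≐S x y) h))
                      , (λ h → proj₂ (R≐S x y) (proj₂ (S≐T x y) h))

  ≐-setoid : Setoid (lsuc 0ℓ) 0ℓ
  ≐-setoid = record
    { Carrier       = PI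
    ; _≈_           = _≐_
    ; isEquivalence = record { refl = ≐-refl ; sym = ≐-sym ; trans = ≐-trans }
    }

  module ≐-Reasoning = SetoidReasoning ≐-setoid

  ∘-cong : ∀ {R R' S S'} → R ≐ R' → S ≐ S' → R ∘ S ≐ R' ∘ S'
  ∘-cong R≐R' S≐S' x z = (λ (y , Sxy , Ryz) → y , proj₁ (S≐S' x y) Sxy , proj₁ (R≐R' y z) Ryz)
                       , (λ (y , Sxy , Ryz) → y , proj₂ (S≐S' x y) Sxy , proj₂ (R≐R' y z) Ryz)

  ᵒ-cong : ∀ {R S} → R ≐ S → R ᵒ ≐ S ᵒ
  ᵒ-cong R≐S x y = R≐S y x

  ∘-assoc : ∀ {R S T} → (R ∘ S) ∘ T ≐ R ∘ (S ∘ T)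
  ∘-assoc _ _ = (λ (y , Txy , (w , Syw , Rwz)) → w , (y , Txy , Syw) , Rwz)
              , (λ (w , (y , Txy , Syw) , Rwz) → y , Txy , (w , Syw , Rwz))

  ᵒ-∘ : ∀ {R S} → (R ∘ S) ᵒ ≐ S ᵒ ∘ R ᵒ
  ᵒ-∘ _ _ = (λ (y , Szy , Ryx) → y , Ryx , Szy) , (λ (y , Ryx , Szy) → y , Szy , Ryx)

  ∘-zeroˡ : ∀ {R} → Zero ∘ R ≐ Zero
  ∘-zeroˡ _ _ = (λ ()) , (λ ())

  ∘-zeroʳ : ∀ {R} → R ∘ Zero ≐ Zero
  ∘-zeroʳ _ _ = (λ ()) , (λ ())

  Commute-cong : ∀ {R R' S S'} → R ≐ R' → S ≐ S' → Commute R' S' → Commute R S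
  Commute-cong R≐R' S≐S' R'S'≐S'R' =
    ≐-trans (∘-cong R≐R' S≐S') (≐-trans R'S'≐S'R' (∘-cong (≐-sym S≐S') (≐-sym R≐R')))

  ⊥⊥-cong : ∀ {R R' S S'} → R ≐ R' → S ≐ S' → R' ⊥⊥ S' → R ⊥⊥ S
  ⊥⊥-cong R≐R' S≐S' (disjoint , R'-inverse , S'-inverse) =
      ≐-trans (∘-cong (∘-cong R≐R' (ᵒ-cong R≐R')) (∘-cong S≐S' (ᵒ-cong S≐S'))) disjoint
    , ≐-trans (∘-cong (ᵒ-cong R≐R') R≐R') R'-inverse
    , ≐-trans (∘-cong (ᵒ-cong S≐S') S≐S') S'-inverse

  isPartialInjection-resp-≐ : ∀ {R S} → R ≐ S → IsPartialInjection R → IsPartialInjection S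
  isPartialInjection-resp-≐ {R} {S} R≐S (R-resp , R-functional , R-injective) =
    resp , functional , injective
    where
    resp : ∀ {x x' y y'} → x ≈ₜ x' → y ≈ₜ y' → S x y → S x' y'
    resp {x} {x'} {y} {y'} x≈x' y≈y' Sxy =
      proj₁ (R≐S x' y') (R-resp x≈x' y≈y' (proj₂ (R≐S x y) Sxy))
    functional : ∀ {x y y'} → S x y → S x y' → y ≈ₜ y'
    functional {x} {y} {y'} Sxy Sxy' = R-functional (proj₂ (R≐S x y) Sxy) (proj₂ (R≐S x y') Sxy')
    injective : ∀ {x x' y} → S x y → S x' y → x ≈ₜ x'
    injective {x} {x'} {y} Sxy Sx'y = R-injective (proj₂ (R≐S x y) Sxy) (proj₂ (R≐S x' y) Sx'y)

  ∘-isPartialInjection : ∀ {R S} → IsPartialInjection R → IsPartialInjection S →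
                         IsPartialInjection (R ∘ S)
  ∘-isPartialInjection {R} {S} (R-resp , R-functional , R-injective)
                               (S-resp , S-functional , S-injective) =
    resp , functional , injective
    where
    resp : ∀ {x x' z z'} → x ≈ₜ x' → z ≈ₜ z' → (R ∘ S) x z → (R ∘ S) x' z'
    resp x≈x' z≈z' (y , Sxy , Ryz) =
      y , S-resp x≈x' (≈ₜ-refl y) Sxy , R-resp (≈ₜ-refl y) z≈z' Ryz
    functional : ∀ {x z z'} → (R ∘ S) x z → (R ∘ S) x z' → z ≈ₜ z'
    functional {z' = z'} (y , Sxy , Ryz) (y' , Sxy' , Ry'z') =
      R-functional Ryz (R-resp {y' = z'} (S-functional Sxy' Sxy) (≈ₜ-refl z') Ry'z')
    injective : ∀ {x x' z} → (R ∘ S) x z → (R ∘ S) x' z → x ≈ₜ x'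
    injective {x' = x'} (y , Sxy , Ryz) (y' , Sx'y' , Ry'z) =
      S-injective Sxy (S-resp {x' = x'} (≈ₜ-refl x') (R-injective Ry'z Ryz) Sx'y')

  ᵒ-isPartialInjection : ∀ {R} → IsPartialInjection R → IsPartialInjection (R ᵒ)
  ᵒ-isPartialInjection (resp , functional , injective) =
    (λ x≈x' y≈y' → resp y≈y' x≈x') , injective , functional

  Restrict : (Token → Set) → PI
  Restrict P x y = P x × x ≈ₜ y

  Range : PI → Token → Set
  Range R y = ∃ λ x → R x y

  Total : PI → Set
  Total R = ∀ x → ∃ (R x)

  module _ {P : Token → Set} where

    Restrict-isPartialInjection : P Respects _≈ₜ_ → IsPartialInjection (Restrict P)
    Restrict-isPartialInjection P-resp =
        (λ {x} {x'} {y} {y'} x≈x' y≈y' (Px , x≈y) →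
           P-resp x≈x' Px , (begin x' ≈⟨ x≈x' ⟨ x ≈⟨ x≈y ⟩ y ≈⟨ y≈y' ⟩ y' ∎))
      , (λ {x} {y} {y'} (_ , x≈y) (_ , x≈y') → begin y ≈⟨ x≈y ⟨ x ≈⟨ x≈y' ⟩ y' ∎)
      , (λ {x} {x'} {y} (_ , x≈y) (_ , x'≈y) → begin x ≈⟨ x≈y ⟩ y ≈⟨ x'≈y ⟨ x' ∎)
      where open ≈ₜ-Reasoning

    Restrict-idempotent : Restrict P ∘ Restrict P ≐ Restrict P
    Restrict-idempotent x z = (λ (y , (Px , x≈y) , (_ , y≈z)) → Px , ≈ₜ-trans {x} {y} {z} x≈y y≈z)
                            , (λ (Px , x≈z) → x , (Px , ≈ₜ-refl x) , (Px , x≈z))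

    Restrict-commute : ∀ {B} → (∀ {x y} → B x y → (P x → P y) × (P y → P x)) →
                       IsPartialInjection B → Commute (Restrict P) B
    Restrict-commute {B} invariant (B-resp , _ , _) x z = to , from
      where
      to : (Restrict P ∘ B) x z → (B ∘ Restrict P) x z
      to (y , Bxy , (Py , y≈z)) = x , (proj₂ (invariant Bxy) Py , ≈ₜ-refl x) , B-resp (≈ₜ-refl x) y≈z Bxy
      from : (B ∘ Restrict P) x z → (Restrict P ∘ B) x z
      from (y , (Px , x≈y) , Byz) = z , Bxz , (proj₁ (invariant Bxz) Px , ≈ₜ-refl z)
        where
        Bxz : B x z
        Bxz = B-resp (≈ₜ-sym {x} {y} x≈y) (≈ₜ-refl z) Byz

  module _ {R : PI} (R-isPartialInjection : IsPartialInjection R) where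

    private
      resp = proj₁ R-isPartialInjection
      functional = proj₁ (proj₂ R-isPartialInjection)
      injective = proj₂ (proj₂ R-isPartialInjection)

    Id-∘ : Id ∘ R ≐ R
    Id-∘ x z = (λ (y , Rxy , y≈z) → resp (≈ₜ-refl x) y≈z Rxy)
             , (λ Rxz → z , Rxz , ≈ₜ-refl z)

    ∘-Id : R ∘ Id ≐ R
    ∘-Id x z = (λ (y , x≈y , Ryz) → resp (≈ₜ-sym {x} {y} x≈y) (≈ₜ-refl z) Ryz)
             , (λ Rxz → x , ≈ₜ-refl x , Rxz)

    ∘-regular : (R ∘ R ᵒ) ∘ R ≐ R
    ∘-regular x z = (λ (y , Rxy , (y' , Ry'y , Ry'z)) → resp (injective Ry'y Rxy) (≈ₜ-refl z) Ry'z)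
                  , (λ Rxz → z , Rxz , (x , Rxz , Rxz))

    ᵒ∘≐Id : Total R → R ᵒ ∘ R ≐ Id
    ᵒ∘≐Id total x z = (λ (y , Rxy , Rzy) → injective Rxy Rzy)
                    , (λ x≈z → let (y , Rzy) = total z in
                                y , resp (≈ₜ-sym {x} {z} x≈z) (≈ₜ-refl y) Rzy , Rzy)

    Range-respects : Range R Respects _≈ₜ_
    Range-respects y≈y' (x , Rxy) = x , resp (≈ₜ-refl x) y≈y' Rxy

    ∘ᵒ≐Restrict-Range : R ∘ R ᵒ ≐ Restrict (Range R)
    ∘ᵒ≐Restrict-Range x y = (λ (w , Rwx , Rwy) → (w , Rwx) , functional Rwx Rwy)
                          , (λ ((w , Rwx) , x≈y) → w , Rwx , resp (≈ₜ-refl w) x≈y Rwx)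

  idempotents-commute : ∀ {R S} → IsPartialInjection R → IsPartialInjection S →
                        Commute (R ∘ R ᵒ) (S ∘ S ᵒ)
  idempotents-commute {R} {S} R-pi S-pi = begin
    (R ∘ R ᵒ) ∘ (S ∘ S ᵒ)                   ≈⟨ ∘-cong (∘ᵒ≐Restrict-Range R-pi) (∘ᵒ≐Restrict-Range S-pi) ⟩
    Restrict (Range R) ∘ Restrict (Range S) ≈⟨ Restrict-commute invariant S-restriction ⟩
    Restrict (Range S) ∘ Restrict (Range R) ≈⟨ ∘-cong (∘ᵒ≐Restrict-Range S-pi) (∘ᵒ≐Restrict-Range R-pi) ⟨
    (S ∘ S ᵒ) ∘ (R ∘ R ᵒ)                   ∎
    where
    open ≐-Reasoning
    S-restriction : IsPartialInjection (Restrict (Range S))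
    S-restriction = Restrict-isPartialInjection (Range-respects S-pi)
    invariant : ∀ {x y} → Restrict (Range S) x y → (Range R x → Range R y) × (Range R y → Range R x)
    invariant {x} {y} (_ , x≈y) = Range-respects R-pi x≈y , Range-respects R-pi (≈ₜ-sym {x} {y} x≈y)

  ∘ᵒ-disjoint : ∀ {R S} → (∀ y → Range R y → Range S y → ⊥) → (R ∘ R ᵒ) ∘ (S ∘ S ᵒ) ≐ Zero
  ∘ᵒ-disjoint disjoint _ _ = (λ (y , (w , Swx , Swy) , (w' , Rw'y , Rw'z)) → disjoint y (w' , Rw'y) (w , Swy))
                           , (λ ())

  ⊥⊥-intro : ∀ {R S} → IsPartialInjection R → IsPartialInjection S → Total R → Total S →
             (∀ y → Range R y → Range S y → ⊥) → R ⊥⊥ S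
  ⊥⊥-intro R-pi S-pi R-total S-total disjoint =
    ∘ᵒ-disjoint disjoint , ᵒ∘≐Id R-pi R-total , ᵒ∘≐Id S-pi S-total

  -- Lenses on tokens

  record Lens (C : Set) : Set where
    field
      get      : Token → C
      put      : Token → C → Token
      get-put  : ∀ x c → get (put x c) ≡ c
      put-get  : ∀ x → put x (get x) ≈ₜ x
      put-put  : ∀ x c c' → put (put x c) c' ≈ₜ put x c'
      put-cong : ∀ {x y} c → x ≈ₜ y → put x c ≈ₜ put y c
      get-cong : ∀ {x y} → x ≈ₜ y → get x ≡ get y

  mLens : Lens Word
  mLens = record
    { get      = M
    ; put      = λ x w → record x { M = w }
    ; get-put  = λ _ _ → refl
    ; put-get  = ≈ₜ-refl
    ; put-put  = λ x _ w → ≈ₜ-refl (record x { M = w })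
    ; put-cong = λ _ (_ , e? , e! , g) → refl , e? , e! , g
    ; get-cong = proj₁
    }

  register : Name → Lens Word
  register α = record
    { get      = λ x → f x α
    ; put      = λ x w → setF x α w
    ; get-put  = λ x w → update-≡ (f x) α w
    ; put-get  = λ x → refl , refl , refl , update-id (f x) α
    ; put-put  = λ x w w' → refl , refl , refl , update-update (f x) α w w'
    ; put-cong = λ w (m , e? , e! , g) → m , e? , e! , update-cong α g refl
    ; get-cong = λ (_ , _ , _ , g) → g α
    }

  stackLens : Tag → Lens (List Word)
  stackLens t = record
    { get      = stack t
    ; put      = λ x E → setStack t E x
    ; get-put  = get-put t
    ; put-get  = put-get t
    ; put-put  = put-put t
    ; put-cong = put-cong t
    ; get-cong = get-cong t
    }
    where
    get-put : ∀ t x E → stack t (setStack t E x) ≡ E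
    get-put t? _ _ = refl
    get-put t! _ _ = refl
    put-get : ∀ t x → setStack t (stack t x) x ≈ₜ x
    put-get t? = ≈ₜ-refl
    put-get t! = ≈ₜ-refl
    put-put : ∀ t x E E' → setStack t E' (setStack t E x) ≈ₜ setStack t E' x
    put-put t? x _ E' = ≈ₜ-refl (setStack t? E' x)
    put-put t! x _ E' = ≈ₜ-refl (setStack t! E' x)
    put-cong : ∀ t {x y} E → x ≈ₜ y → setStack t E x ≈ₜ setStack t E y
    put-cong t? _ (m , _ , e! , g) = m , refl , e! , g
    put-cong t! _ (m , e? , _ , g) = m , e? , refl , g
    get-cong : ∀ t {x y} → x ≈ₜ y → stack t x ≡ stack t y
    get-cong t? (_ , e? , _ , _) = e?
    get-cong t! (_ , _ , e! , _) = e!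

  record Disjoint {C D : Set} (ℓ : Lens C) (ℓ' : Lens D) : Set where
    open Lens
    field
      get-put′ : ∀ x c' → get ℓ (put ℓ' x c') ≡ get ℓ x
      get′-put : ∀ x c → get ℓ' (put ℓ x c) ≡ get ℓ' x
      put-comm : ∀ x c c' → put ℓ (put ℓ' x c') c ≈ₜ put ℓ' (put ℓ x c) c'

  register-mLens-disjoint : ∀ α → Disjoint (register α) mLens
  register-mLens-disjoint α = record
    { get-put′ = λ _ _ → refl
    ; get′-put = λ _ _ → refl
    ; put-comm = λ x w w' → ≈ₜ-refl (setF (record x { M = w' }) α w)
    }

  register-stackLens-disjoint : ∀ α t → Disjoint (register α) (stackLens t)
  register-stackLens-disjoint α t = record
    { get-put′ = get-put′ t
    ; get′-put = get′-put t
    ; put-comm = put-comm t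
    }
    where
    get-put′ : ∀ t x E → f (setStack t E x) α ≡ f x α
    get-put′ t? _ _ = refl
    get-put′ t! _ _ = refl
    get′-put : ∀ t x w → stack t (setF x α w) ≡ stack t x
    get′-put t? _ _ = refl
    get′-put t! _ _ = refl
    put-comm : ∀ t x w E → setF (setStack t E x) α w ≈ₜ setStack t E (setF x α w)
    put-comm t? x w E = ≈ₜ-refl (setStack t? E (setF x α w))
    put-comm t! x w E = ≈ₜ-refl (setStack t! E (setF x α w))

  register-disjoint : ∀ {α β} → α ≢ β → Disjoint (register α) (register β)
  register-disjoint {α} {β} α≢β = record
    { get-put′ = λ x w → update-≢ (f x) β w α≢β
    ; get′-put = λ x w → update-≢ (f x) α w (≢-sym α≢β)
    ; put-comm = λ x w w' → refl , refl , refl , update-comm (f x) w w' α≢β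
    }

  stackLens-disjoint : ∀ t → Disjoint (stackLens t) (stackLens (dual t))
  stackLens-disjoint t? = record
    { get-put′ = λ _ _ → refl
    ; get′-put = λ _ _ → refl
    ; put-comm = λ x E? E! → ≈ₜ-refl (record x { E? = E? ; E! = E! })
    }
  stackLens-disjoint t! = record
    { get-put′ = λ _ _ → refl
    ; get′-put = λ _ _ → refl
    ; put-comm = λ x E! E? → ≈ₜ-refl (record x { E? = E? ; E! = E! })
    }

  Fun : (Token → Token) → PI
  Fun F = Graph (λ x → just (F x))

  PartialInjective : {A : Set} → (A → Maybe A) → Set
  PartialInjective φ = ∀ {a a' c} → φ a ≡ just c → φ a' ≡ just c → a ≡ a'

  module _ {C : Set} (ℓ : Lens C) where

    open Lens ℓ

    Via : (C → Maybe C) → PI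
    Via φ x y = ∃ λ c → φ (get x) ≡ just c × put x c ≈ₜ y

    put-≡ : ∀ {x c} → get x ≡ c → put x c ≈ₜ x
    put-≡ {x} refl = put-get x

    put-≈⇒≡ : ∀ {x x' c c'} → put x c ≈ₜ put x' c' → c ≡ c'
    put-≈⇒≡ {x} {x'} {c} {c'} eq = trans (sym (get-put x c)) (trans (get-cong eq) (get-put x' c'))

    put-injective : ∀ {x x' c} → put x c ≈ₜ put x' c → get x ≡ get x' → x ≈ₜ x'
    put-injective {x} {x'} {c} eq gx≡gx' = begin
      x                      ≈⟨ put-get x ⟨
      put x (get x)          ≈⟨ put-put x c (get x) ⟨
      put (put x c) (get x)  ≈⟨ put-cong (get x) eq ⟩
      put (put x' c) (get x) ≈⟨ put-put x' c (get x) ⟩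
      put x' (get x)         ≡⟨ cong (put x') gx≡gx' ⟩
      put x' (get x')        ≈⟨ put-get x' ⟩
      x'                     ∎
      where open ≈ₜ-Reasoning

    Graph≐Via : ∀ {g} φ → (∀ x → g x ≡ map (put x) (φ (get x))) → Graph g ≐ Via φ
    Graph≐Via {g} φ g≡ x y = to , from
      where
      to : Graph g x y → Via φ x y
      to (z , gx≡z , z≈y) with φ (get x) | trans (sym gx≡z) (g≡ x)
      ... | just c | refl = c , refl , z≈y
      from : Via φ x y → Graph g x y
      from (c , φx≡c , xc≈y) = put x c , trans (g≡ x) (cong (map (put x)) φx≡c) , xc≈y

    Via-isPartialInjection : ∀ {φ} → PartialInjective φ → IsPartialInjection (Via φ)
    Via-isPartialInjection {φ} φ-injective =
        (λ {x} {x'} {y} {y'} x≈x' y≈y' (c , φx≡c , xc≈y) →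
           c , trans (cong φ (get-cong (≈ₜ-sym {x} {x'} x≈x'))) φx≡c ,
           (begin put x' c ≈⟨ put-cong c x≈x' ⟨ put x c ≈⟨ xc≈y ⟩ y ≈⟨ y≈y' ⟩ y' ∎))
      , (λ {x} {y} {y'} (c , φx≡c , xc≈y) (c' , φx≡c' , xc'≈y') →
           begin
             y        ≈⟨ xc≈y ⟨
             put x c  ≡⟨ cong (put x) (just-injective (trans (sym φx≡c) φx≡c')) ⟩
             put x c' ≈⟨ xc'≈y' ⟩
             y'       ∎)
      , (λ {x} {x'} {y} (c , φx≡c , xc≈y) (c' , φx'≡c' , x'c'≈y) →
           let c≡c' = put-≈⇒≡ (begin put x c ≈⟨ xc≈y ⟩ y ≈⟨ x'c'≈y ⟨ put x' c' ∎) in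
           put-injective {x} {x'} {c}
             (begin put x c ≈⟨ xc≈y ⟩ y ≈⟨ x'c'≈y ⟨ put x' c' ≡⟨ cong (put x') c≡c' ⟨ put x' c ∎)
             (φ-injective φx≡c (trans φx'≡c' (cong just (sym c≡c')))))
      where open ≈ₜ-Reasoning

    Independent : PI → Set
    Independent B = (∀ {x y} c → B x y → B (put x c) (put y c))
                  × (∀ {x y} → B x y → get x ≡ get y)

    Independent-ᵒ : ∀ {B} → Independent B → Independent (B ᵒ)
    Independent-ᵒ (B-put , B-get) = B-put , (λ Byx → sym (B-get Byx))

    Independent-resp-≐ : ∀ {B B'} → B ≐ B' → Independent B → Independent B'
    Independent-resp-≐ B≐B' (B-put , B-get) =
        (λ {x} {y} c B'xy → proj₁ (B≐B' (put x c) (put y c)) (B-put c (proj₂ (B≐B' x y) B'xy)))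
      , (λ {x} {y} B'xy → B-get (proj₂ (B≐B' x y) B'xy))

    Fun-independent : ∀ {F} → (∀ x c → F (put x c) ≈ₜ put (F x) c) → (∀ x → get (F x) ≡ get x) →
                      Independent (Fun F)
    Fun-independent {F} F-put F-get = F-independent-put , F-independent-get
      where
      open ≈ₜ-Reasoning
      F-independent-put : ∀ {x y} c → Fun F x y → Fun F (put x c) (put y c)
      F-independent-put {x} {y} c (_ , refl , Fx≈y) =
        _ , refl , (begin F (put x c) ≈⟨ F-put x c ⟩ put (F x) c ≈⟨ put-cong c Fx≈y ⟩ put y c ∎)
      F-independent-get : ∀ {x y} → Fun F x y → get x ≡ get y
      F-independent-get {x} (_ , refl , Fx≈y) = trans (sym (F-get x)) (get-cong Fx≈y)

    Restrict-independent : ∀ {P} → (∀ {x} c → P x → P (put x c)) → Independent (Restrict P)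
    Restrict-independent P-put = (λ c (Px , x≈y) → P-put c Px , put-cong c x≈y)
                               , (λ (_ , x≈y) → get-cong x≈y)

    Via-commute : ∀ φ {B} → Independent B → IsPartialInjection B → Commute (Via φ) B
    Via-commute φ {B} (B-put , B-get) (B-resp , _ , _) x z = to , from
      where
      open ≈ₜ-Reasoning
      to : (Via φ ∘ B) x z → (B ∘ Via φ) x z
      to (y , Bxy , (c , φy≡c , yc≈z)) =
          put x c
        , (c , trans (cong φ (B-get Bxy)) φy≡c , ≈ₜ-refl (put x c))
        , B-resp (≈ₜ-refl (put x c)) yc≈z (B-put c Bxy)
      from : (B ∘ Via φ) x z → (Via φ ∘ B) x z
      from (y , (c , φx≡c , xc≈y) , Byz) =
          put z (get x)
        , B-resp y-restored (≈ₜ-refl (put z (get x))) (B-put (get x) Byz)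
        , (c , trans (cong φ (get-put z (get x))) φx≡c , z-restored)
        where
        y-restored : put y (get x) ≈ₜ x
        y-restored = begin
          put y (get x)         ≈⟨ put-cong (get x) xc≈y ⟨
          put (put x c) (get x) ≈⟨ put-put x c (get x) ⟩
          put x (get x)         ≈⟨ put-get x ⟩
          x                     ∎
        gz≡c : get z ≡ c
        gz≡c = trans (sym (B-get Byz)) (trans (sym (get-cong xc≈y)) (get-put x c))
        z-restored : put (put z (get x)) c ≈ₜ z
        z-restored = begin
          put (put z (get x)) c ≈⟨ put-put z (get x) c ⟩
          put z c               ≈⟨ put-≡ gz≡c ⟩
          z                     ∎

  Via-independent : ∀ {C D} {ℓ : Lens C} {ℓ' : Lens D} → Disjoint ℓ ℓ' → ∀ φ → Independent ℓ (Via ℓ' φ)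
  Via-independent {ℓ = ℓ} {ℓ'} disjoint φ =
      (λ {x} {y} c (c' , φx≡c' , xc'≈y) →
           c' , trans (cong φ (get′-put x c)) φx≡c'
         , (begin
              put ℓ' (put ℓ x c) c' ≈⟨ put-comm x c c' ⟨
              put ℓ (put ℓ' x c') c ≈⟨ put-cong ℓ c xc'≈y ⟩
              put ℓ y c            ∎))
    , (λ {x} (c' , _ , xc'≈y) → trans (sym (get-put′ x c')) (get-cong ℓ xc'≈y))
    where
    open Lens
    open Disjoint disjoint
    open ≈ₜ-Reasoning

  -- The generators

  push : Bool → Word → Maybe Word
  push b w = just (b ∷ w)

  pushHead : Bool → List Word → Maybe (List Word)
  pushHead b []      = nothing
  pushHead b (σ ∷ E) = just ((b ∷ σ) ∷ E)

  push-injective : ∀ b → PartialInjective (push b)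
  push-injective b refl refl = refl

  pushHead-injective : ∀ b → PartialInjective (pushHead b)
  pushHead-injective b {_ ∷ _} {_ ∷ _} refl refl = refl
  pushHead-injective b {[]} ()
  pushHead-injective b {_ ∷ _} {[]} _ ()

  pushHead-just : ∀ {b E c} → pushHead b E ≡ just c → ∃₂ λ σ E' → E ≡ σ ∷ E' × c ≡ (b ∷ σ) ∷ E'
  pushHead-just {E = _ ∷ _} refl = _ , _ , refl , refl

  pushM≐Via : ∀ b → Graph (pushM b) ≐ Via mLens (push b)
  pushM≐Via b = Graph≐Via mLens (push b) (λ _ → refl)

  pushF≐Via : ∀ b α → Graph (pushF b α) ≐ Via (register α) (push b)
  pushF≐Via b α = Graph≐Via (register α) (push b) (λ _ → refl)

  pushF-setF : ∀ {b α x σ} → f x α ≡ b ∷ σ → Graph (pushF b α) (setF x α σ) x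
  pushF-setF {b} {α} {x} {σ} fxα≡bσ = _ , refl , (begin
    put (put x σ) (b ∷ get (put x σ)) ≡⟨ cong (λ w → put (put x σ) (b ∷ w)) (get-put x σ) ⟩
    put (put x σ) (b ∷ σ)             ≈⟨ put-put x σ (b ∷ σ) ⟩
    put x (b ∷ σ)                     ≈⟨ put-≡ (register α) {x} fxα≡bσ ⟩
    x                                 ∎)
    where
    open Lens (register α)
    open ≈ₜ-Reasoning

  pushTop≐Via : ∀ b t → Graph (pushTop b t) ≐ Via (stackLens t) (pushHead b)
  pushTop≐Via b t = Graph≐Via (stackLens t) (pushHead b) pushTop-map
    where
    pushTop-map : ∀ x → pushTop b t x ≡ map (λ E → setStack t E x) (pushHead b (stack t x))
    pushTop-map x with stack t x
    ... | []    = refl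
    ... | _ ∷ _ = refl

  dmap′ : Tag → Name → Token → Token
  dmap′ t α x = setStack t ([] ∷ stack t x) (setStack (dual t) (f x α ∷ stack (dual t) x) x)

  dmap′-cong : ∀ t α → Congruent _≈ₜ_ _≈ₜ_ (dmap′ t α)
  dmap′-cong t? α (m , e? , e! , g) = m , cong ([] ∷_) e? , cong₂ _∷_ (g α) e! , g
  dmap′-cong t! α (m , e? , e! , g) = m , cong₂ _∷_ (g α) e? , cong ([] ∷_) e! , g

  dmap′-injective : ∀ t α → Injective _≈ₜ_ _≈ₜ_ (dmap′ t α)
  dmap′-injective t? α (m , e? , e! , g) = m , ∷-injectiveʳ e? , ∷-injectiveʳ e! , g
  dmap′-injective t! α (m , e? , e! , g) = m , ∷-injectiveʳ e? , ∷-injectiveʳ e! , g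

  Unset : Name → Token → Set
  Unset α x = f x α ≡ []

  Unset-respects : ∀ α → Unset α Respects _≈ₜ_
  Unset-respects α (_ , _ , _ , g) fxα≡[] = trans (sym (g α)) fxα≡[]

  emap≐Restrict : ∀ α → Graph (emap α) ≐ Restrict (Unset α)
  emap≐Restrict α x y = to , from
    where
    to : Graph (emap α) x y → Restrict (Unset α) x y
    to (_ , eq , z≈y) with f x α
    to (_ , refl , x≈y) | []    = refl , x≈y
    to (_ , ()   , _)   | _ ∷ _
    from : Restrict (Unset α) x y → Graph (emap α) x y
    from (fxα≡[] , x≈y) with f x α | fxα≡[]
    ... | .[] | refl = x , refl , x≈y

  Fun-isPartialInjection : ∀ {F} → Congruent _≈ₜ_ _≈ₜ_ F → Injective _≈ₜ_ _≈ₜ_ F →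
                           IsPartialInjection (Fun F)
  Fun-isPartialInjection {F} F-cong F-injective =
      (λ {x} {x'} {y} {y'} x≈x' y≈y' → λ { (_ , refl , Fx≈y) →
         _ , refl , (begin F x' ≈⟨ F-cong x≈x' ⟨ F x ≈⟨ Fx≈y ⟩ y ≈⟨ y≈y' ⟩ y' ∎) })
    , (λ {x} {y} {y'} → λ { (_ , refl , Fx≈y) (_ , refl , Fx≈y') →
         begin y ≈⟨ Fx≈y ⟨ F x ≈⟨ Fx≈y' ⟩ y' ∎ })
    , (λ {x} {x'} {y} → λ { (_ , refl , Fx≈y) (_ , refl , Fx'≈y) →
         F-injective (begin F x ≈⟨ Fx≈y ⟩ y ≈⟨ Fx'≈y ⟨ F x' ∎) })
    where open ≈ₜ-Reasoning

  pushM-isPartialInjection : ∀ b → IsPartialInjection (Graph (pushM b))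
  pushM-isPartialInjection b =
    isPartialInjection-resp-≐ (≐-sym (pushM≐Via b)) (Via-isPartialInjection mLens (push-injective b))

  pushF-isPartialInjection : ∀ b α → IsPartialInjection (Graph (pushF b α))
  pushF-isPartialInjection b α =
    isPartialInjection-resp-≐ (≐-sym (pushF≐Via b α))
      (Via-isPartialInjection (register α) (push-injective b))

  pushTop-isPartialInjection : ∀ b t → IsPartialInjection (Graph (pushTop b t))
  pushTop-isPartialInjection b t =
    isPartialInjection-resp-≐ (≐-sym (pushTop≐Via b t))
      (Via-isPartialInjection (stackLens t) (pushHead-injective b))

  ⟦⟧-isPartialInjection : ∀ o → IsPartialInjection ⟦ o ⟧
  ⟦⟧-isPartialInjection p       = pushM-isPartialInjection false
  ⟦⟧-isPartialInjection q       = pushM-isPartialInjection true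
  ⟦⟧-isPartialInjection (r t)   = pushTop-isPartialInjection false t
  ⟦⟧-isPartialInjection (s t)   = pushTop-isPartialInjection true t
  ⟦⟧-isPartialInjection (d t α) = Fun-isPartialInjection (dmap′-cong t α) (dmap′-injective t α)
  ⟦⟧-isPartialInjection (u α)   = pushF-isPartialInjection false α
  ⟦⟧-isPartialInjection (v α)   = pushF-isPartialInjection true α
  ⟦⟧-isPartialInjection (e α)   =
    isPartialInjection-resp-≐ (≐-sym (emap≐Restrict α))
      (Restrict-isPartialInjection (λ {x} {y} → Unset-respects α {x} {y}))

  InM⇒isPartialInjection : ∀ {R} → InM R → IsPartialInjection R
  InM⇒isPartialInjection (gen o)     = ⟦⟧-isPartialInjection o
  InM⇒isPartialInjection (comp R S)  = ∘-isPartialInjection (InM⇒isPartialInjection R) (InM⇒isPartialInjection S)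
  InM⇒isPartialInjection (inv R)     = ᵒ-isPartialInjection (InM⇒isPartialInjection R)
  InM⇒isPartialInjection (ext R R≐S) = isPartialInjection-resp-≐ R≐S (InM⇒isPartialInjection R)

  Via-push-⊥⊥ : (ℓ : Lens Word) → Via ℓ (push false) ⊥⊥ Via ℓ (push true)
  Via-push-⊥⊥ ℓ = ⊥⊥-intro (Via-isPartialInjection ℓ (push-injective false))
                           (Via-isPartialInjection ℓ (push-injective true))
                           (total false) (total true) disjoint
    where
    open Lens ℓ
    open ≈ₜ-Reasoning
    total : ∀ b → Total (Via ℓ (push b))
    total b x = put x (b ∷ get x) , b ∷ get x , refl , ≈ₜ-refl (put x (b ∷ get x))
    disjoint : ∀ y → Range (Via ℓ (push false)) y → Range (Via ℓ (push true)) y → ⊥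
    disjoint y (x , _ , refl , x0≈y) (x' , _ , refl , x'1≈y)
      with ∷-injectiveˡ (put-≈⇒≡ ℓ (begin put x (false ∷ get x) ≈⟨ x0≈y ⟩ y ≈⟨ x'1≈y ⟨ put x' (true ∷ get x') ∎))
    ... | ()

  p⊥⊥q : ⟦ p ⟧ ⊥⊥ ⟦ q ⟧
  p⊥⊥q = ⊥⊥-cong (pushM≐Via false) (pushM≐Via true) (Via-push-⊥⊥ mLens)

  u⊥⊥v : ∀ α → ⟦ u α ⟧ ⊥⊥ ⟦ v α ⟧
  u⊥⊥v α = ⊥⊥-cong (pushF≐Via false α) (pushF≐Via true α) (Via-push-⊥⊥ (register α))

  Id∈M : InM Id
  Id∈M = ext (comp (inv (gen p)) (gen p)) (proj₁ (proj₂ p⊥⊥q))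

  Zero∈M : InM Zero
  Zero∈M = ext (comp (comp (gen p) (inv (gen p))) (comp (gen q) (inv (gen q)))) (proj₁ p⊥⊥q)

  isInverseMonoidWithZero : IsInverseMonoidWithZero _≈ᴹ_ _·ᴹ_ _⋆ᴹ (Id , Id∈M) (Zero , Zero∈M)
  isInverseMonoidWithZero = record
    { isMonoid  = record
      { isSemigroup = record
        { isMagma = record
          { isEquivalence = record { refl = ≐-refl ; sym = ≐-sym ; trans = ≐-trans }
          ; ∙-cong        = ∘-cong
          }
        ; assoc = λ _ _ _ → ∘-assoc
        }
      ; identity = (λ (_ , R∈M) → Id-∘ (InM⇒isPartialInjection R∈M))
                 , (λ (_ , R∈M) → ∘-Id (InM⇒isPartialInjection R∈M))
      }
    ; ⋆-cong    = ᵒ-cong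
    ; ⋆-anti    = λ _ _ → ᵒ-∘
    ; ⋆-invol   = λ _ → ≐-refl
    ; regular   = λ (_ , R∈M) → ∘-regular (InM⇒isPartialInjection R∈M)
    ; idem-comm = λ (_ , R∈M) (_ , S∈M) →
                    idempotents-commute (InM⇒isPartialInjection R∈M) (InM⇒isPartialInjection S∈M)
    ; zeroʳ     = λ _ → ∘-zeroʳ
    ; zeroˡ     = λ _ → ∘-zeroˡ
    }

  -- The relations

  e-idempotent : ∀ α → ⟦ e α ⟧ ∘ ⟦ e α ⟧ ≐ ⟦ e α ⟧
  e-idempotent α = begin
    ⟦ e α ⟧ ∘ ⟦ e α ⟧                       ≈⟨ ∘-cong (emap≐Restrict α) (emap≐Restrict α) ⟩
    Restrict (Unset α) ∘ Restrict (Unset α) ≈⟨ Restrict-idempotent ⟩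
    Restrict (Unset α)                      ≈⟨ emap≐Restrict α ⟨
    ⟦ e α ⟧                                 ∎
    where open ≐-Reasoning

  pushTop-commute-ᵒ : ∀ t b b' → Commute (Graph (pushTop b t)) (Graph (pushTop b' (dual t)) ᵒ)
  pushTop-commute-ᵒ t b b' =
    Commute-cong (pushTop≐Via b t) ≐-refl
      (Via-commute (stackLens t) (pushHead b) (Independent-ᵒ (stackLens t) independent)
        (ᵒ-isPartialInjection (pushTop-isPartialInjection b' (dual t))))
    where
    independent : Independent (stackLens t) (Graph (pushTop b' (dual t)))
    independent = Independent-resp-≐ (stackLens t) (≐-sym (pushTop≐Via b' (dual t)))
                    (Via-independent (stackLens-disjoint t) (pushHead b'))

  rs!-commute-rs?ᵒ : ∀ a → a ∈ (r t! ∷ s t! ∷ []) → ∀ b → b ∈ (r t? ∷ s t? ∷ []) → Commute ⟦ a ⟧ (⟦ b ⟧ ᵒ)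
  rs!-commute-rs?ᵒ _ a∈ _ b∈ = lookup (lookup table a∈) b∈
    where
    table : All (λ a → All (λ b → Commute ⟦ a ⟧ (⟦ b ⟧ ᵒ)) (r t? ∷ s t? ∷ [])) (r t! ∷ s t! ∷ [])
    table = (pushTop-commute-ᵒ t! false false ∷ pushTop-commute-ᵒ t! false true ∷ [])
          ∷ (pushTop-commute-ᵒ t! true false ∷ pushTop-commute-ᵒ t! true true ∷ [])
          ∷ []

  pushM-independent : ∀ b α → Independent (register α) (Graph (pushM b))
  pushM-independent b α = Independent-resp-≐ (register α) (≐-sym (pushM≐Via b))
                            (Via-independent (register-mLens-disjoint α) (push b))

  pushTop-independent : ∀ b t α → Independent (register α) (Graph (pushTop b t))
  pushTop-independent b t α = Independent-resp-≐ (register α) (≐-sym (pushTop≐Via b t))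
                                (Via-independent (register-stackLens-disjoint α t) (pushHead b))

  pushF-independent : ∀ b {α β} → α ≢ β → Independent (register α) (Graph (pushF b β))
  pushF-independent b {α} {β} α≢β = Independent-resp-≐ (register α) (≐-sym (pushF≐Via b β))
                                      (Via-independent (register-disjoint α≢β) (push b))

  dmap-independent : ∀ t {α β} → α ≢ β → Independent (register α) (Graph (dmap t β))
  dmap-independent t {α} {β} α≢β = Fun-independent (register α) (commutes t) (preserves t)
    where
    commutes : ∀ t x w → dmap′ t β (setF x α w) ≈ₜ setF (dmap′ t β x) α w
    commutes t? x w = refl , refl , cong (_∷ E! x) (update-≢ (f x) α w (≢-sym α≢β)) , λ _ → refl
    commutes t! x w = refl , cong (_∷ E? x) (update-≢ (f x) α w (≢-sym α≢β)) , refl , λ _ → refl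
    preserves : ∀ t x → f (dmap′ t β x) α ≡ f x α
    preserves t? _ = refl
    preserves t! _ = refl

  emap-independent : ∀ {α β} → α ≢ β → Independent (register α) (Graph (emap β))
  emap-independent {α} {β} α≢β =
    Independent-resp-≐ (register α) (≐-sym (emap≐Restrict β))
      (Restrict-independent (register α) {Unset β}
        (λ {x} w fxβ≡[] → trans (update-≢ (f x) α w (≢-sym α≢β)) fxβ≡[]))

  pushF-commute : ∀ b α {B} → Independent (register α) B → IsPartialInjection B →
                  Commute (Graph (pushF b α)) B
  pushF-commute b α B-independent B-pi =
    Commute-cong (pushF≐Via b α) ≐-refl (Via-commute (register α) (push b) B-independent B-pi)

  emap-commute : ∀ α {B} → Independent (register α) B → IsPartialInjection B →
                 Commute (Graph (emap α)) B
  emap-commute α {B} (_ , B-get) B-pi =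
    Commute-cong (emap≐Restrict α) ≐-refl (Restrict-commute invariant B-pi)
    where
    invariant : ∀ {x y} → B x y → (Unset α x → Unset α y) × (Unset α y → Unset α x)
    invariant Bxy = (λ fxα≡[] → trans (sym (B-get Bxy)) fxα≡[]) , (λ fyα≡[] → trans (B-get Bxy) fyα≡[])

  uve-commute : ∀ α β → α ≢ β → ∀ a → a ∈ (u α ∷ v α ∷ e α ∷ []) →
                ∀ b → b ∈ (p ∷ q ∷ r t? ∷ s t? ∷ r t! ∷ s t! ∷ d t? β ∷ d t! β ∷ u β ∷ v β ∷ e β ∷ []) →
                Commute ⟦ a ⟧ ⟦ b ⟧ × Commute ⟦ a ⟧ (⟦ b ⟧ ᵒ)
  uve-commute α β α≢β _ a∈ b b∈ =
      lookup commutes a∈ B-independent B-pi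
    , lookup commutes a∈ (Independent-ᵒ (register α) B-independent) (ᵒ-isPartialInjection B-pi)
    where
    commutes : All (λ a → ∀ {B} → Independent (register α) B → IsPartialInjection B → Commute ⟦ a ⟧ B)
                   (u α ∷ v α ∷ e α ∷ [])
    commutes = pushF-commute false α ∷ pushF-commute true α ∷ emap-commute α ∷ []
    independent : All (λ b → Independent (register α) ⟦ b ⟧)
                      (p ∷ q ∷ r t? ∷ s t? ∷ r t! ∷ s t! ∷ d t? β ∷ d t! β ∷ u β ∷ v β ∷ e β ∷ [])
    independent = pushM-independent false α ∷ pushM-independent true α
                ∷ pushTop-independent false t? α ∷ pushTop-independent true t? α
                ∷ pushTop-independent false t! α ∷ pushTop-independent true t! α
                ∷ dmap-independent t? α≢β ∷ dmap-independent t! α≢β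
                ∷ pushF-independent false α≢β ∷ pushF-independent true α≢β
                ∷ emap-independent α≢β ∷ []
    B-independent : Independent (register α) ⟦ b ⟧
    B-independent = lookup independent b∈
    B-pi : IsPartialInjection ⟦ b ⟧
    B-pi = ⟦⟧-isPartialInjection b

  d?ᵒ∘pushHead! : ∀ b α → Graph (dmap t? α) ᵒ ∘ Via (stackLens t!) (pushHead b) ≐
                           Graph (pushF b α) ∘ Graph (dmap t? α) ᵒ ∘ Graph (pushF b α) ᵒ
  d?ᵒ∘pushHead! b α x z = to , from
    where
    open ≈ₜ-Reasoning
    to : (Graph (dmap t? α) ᵒ ∘ Via (stackLens t!) (pushHead b)) x z →
         (Graph (pushF b α) ∘ Graph (dmap t? α) ᵒ ∘ Graph (pushF b α) ᵒ) x z
    to (y , (c , pushed , xc≈y) , (_ , refl , Dz≈y)) with pushHead-just pushed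
    ... | σ , E , E!x≡σE , refl =
      unpack (begin dmap′ t? α z ≈⟨ Dz≈y ⟩ y ≈⟨ xc≈y ⟨ setStack t! ((b ∷ σ) ∷ E) x ∎)
      where
      unpack : dmap′ t? α z ≈ₜ setStack t! ((b ∷ σ) ∷ E) x →
               (Graph (pushF b α) ∘ Graph (dmap t? α) ᵒ ∘ Graph (pushF b α) ᵒ) x z
      unpack (m , e? , e! , g) =
          setF x α σ , pushF-setF (trans (sym (g α)) (∷-injectiveˡ e!))
        , (setF z α σ , (_ , refl , Dz′≈x′) , pushF-setF (∷-injectiveˡ e!))
        where
        Dz′≈x′ : dmap′ t? α (setF z α σ) ≈ₜ setF x α σ
        Dz′≈x′ = m , e? , trans (cong₂ _∷_ (update-≡ (f z) α σ) (∷-injectiveʳ e!)) (sym E!x≡σE)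
               , update-cong α g refl
    from : (Graph (pushF b α) ∘ Graph (dmap t? α) ᵒ ∘ Graph (pushF b α) ᵒ) x z →
           (Graph (dmap t? α) ᵒ ∘ Via (stackLens t!) (pushHead b)) x z
    from (y₁ , (_ , refl , (m₁ , e?₁ , e!₁ , g₁)) ,
          (y₂ , (_ , refl , (m₂ , e?₂ , e!₂ , g₂)) , (_ , refl , (m₃ , e?₃ , e!₃ , g₃)))) =
        setStack t! ((b ∷ f y₂ α) ∷ E! y₂) x
      , (_ , cong (pushHead b) (sym (trans e!₂ e!₁)) , ≈ₜ-refl (setStack t! ((b ∷ f y₂ α) ∷ E! y₂) x))
      , (_ , refl , ( trans (sym m₃) (trans m₂ m₁)
                    , trans (cong ([] ∷_) (sym e?₃)) (trans e?₂ e?₁)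
                    , cong₂ _∷_ (trans (sym (g₃ α)) (update-≡ (f y₂) α _)) (sym e!₃)
                    , λ γ → trans (sym (g₃ γ)) (trans (update-cong α g₂ (cong (b ∷_) (g₂ α)) γ) (g₁ γ))))

  d!ᵒ∘pushHead? : ∀ b α → Graph (dmap t! α) ᵒ ∘ Via (stackLens t?) (pushHead b) ≐
                           Graph (pushF b α) ∘ Graph (dmap t! α) ᵒ ∘ Graph (pushF b α) ᵒ
  d!ᵒ∘pushHead? b α x z = to , from
    where
    open ≈ₜ-Reasoning
    to : (Graph (dmap t! α) ᵒ ∘ Via (stackLens t?) (pushHead b)) x z →
         (Graph (pushF b α) ∘ Graph (dmap t! α) ᵒ ∘ Graph (pushF b α) ᵒ) x z
    to (y , (c , pushed , xc≈y) , (_ , refl , Dz≈y)) with pushHead-just pushed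
    ... | σ , E , E?x≡σE , refl =
      unpack (begin dmap′ t! α z ≈⟨ Dz≈y ⟩ y ≈⟨ xc≈y ⟨ setStack t? ((b ∷ σ) ∷ E) x ∎)
      where
      unpack : dmap′ t! α z ≈ₜ setStack t? ((b ∷ σ) ∷ E) x →
               (Graph (pushF b α) ∘ Graph (dmap t! α) ᵒ ∘ Graph (pushF b α) ᵒ) x z
      unpack (m , e? , e! , g) =
          setF x α σ , pushF-setF (trans (sym (g α)) (∷-injectiveˡ e?))
        , (setF z α σ , (_ , refl , Dz′≈x′) , pushF-setF (∷-injectiveˡ e?))
        where
        Dz′≈x′ : dmap′ t! α (setF z α σ) ≈ₜ setF x α σ
        Dz′≈x′ = m , trans (cong₂ _∷_ (update-≡ (f z) α σ) (∷-injectiveʳ e?)) (sym E?x≡σE) , e!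
               , update-cong α g refl
    from : (Graph (pushF b α) ∘ Graph (dmap t! α) ᵒ ∘ Graph (pushF b α) ᵒ) x z →
           (Graph (dmap t! α) ᵒ ∘ Via (stackLens t?) (pushHead b)) x z
    from (y₁ , (_ , refl , (m₁ , e?₁ , e!₁ , g₁)) ,
          (y₂ , (_ , refl , (m₂ , e?₂ , e!₂ , g₂)) , (_ , refl , (m₃ , e?₃ , e!₃ , g₃)))) =
        setStack t? ((b ∷ f y₂ α) ∷ E? y₂) x
      , (_ , cong (pushHead b) (sym (trans e?₂ e?₁)) , ≈ₜ-refl (setStack t? ((b ∷ f y₂ α) ∷ E? y₂) x))
      , (_ , refl , ( trans (sym m₃) (trans m₂ m₁)
                    , cong₂ _∷_ (trans (sym (g₃ α)) (update-≡ (f y₂) α _)) (sym e?₃)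
                    , trans (cong ([] ∷_) (sym e!₃)) (trans e!₂ e!₁)
                    , λ γ → trans (sym (g₃ γ)) (trans (update-cong α g₂ (cong (b ∷_) (g₂ α)) γ) (g₁ γ))))

  dᵒ∘pushTop≐pushF∘dᵒ∘pushFᵒ : ∀ b α t t' → t ≢ t' →
    Graph (dmap t α) ᵒ ∘ Graph (pushTop b t') ≐ Graph (pushF b α) ∘ Graph (dmap t α) ᵒ ∘ Graph (pushF b α) ᵒ
  dᵒ∘pushTop≐pushF∘dᵒ∘pushFᵒ b α t? t? t≢t' = ⊥-elim (t≢t' refl)
  dᵒ∘pushTop≐pushF∘dᵒ∘pushFᵒ b α t? t! _    = ≐-trans (∘-cong ≐-refl (pushTop≐Via b t!)) (d?ᵒ∘pushHead! b α)
  dᵒ∘pushTop≐pushF∘dᵒ∘pushFᵒ b α t! t? _    = ≐-trans (∘-cong ≐-refl (pushTop≐Via b t?)) (d!ᵒ∘pushHead? b α)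
  dᵒ∘pushTop≐pushF∘dᵒ∘pushFᵒ b α t! t! t≢t' = ⊥-elim (t≢t' refl)

  d!ᵒ∘d?≐e∘e : ∀ α β → Graph (dmap t! α) ᵒ ∘ Graph (dmap t? β) ≐ ⟦ e α ⟧ ∘ ⟦ e β ⟧
  d!ᵒ∘d?≐e∘e α β = ≐-trans core (≐-sym (∘-cong (emap≐Restrict α) (emap≐Restrict β)))
    where
    core : Graph (dmap t! α) ᵒ ∘ Graph (dmap t? β) ≐ Restrict (Unset α) ∘ Restrict (Unset β)
    core x z = to , from
      where
      open ≈ₜ-Reasoning
      to : (Graph (dmap t! α) ᵒ ∘ Graph (dmap t? β)) x z → (Restrict (Unset α) ∘ Restrict (Unset β)) x z
      to (y , (_ , refl , Dx≈y) , (_ , refl , Dz≈y)) =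
        unpack (begin dmap′ t? β x ≈⟨ Dx≈y ⟩ y ≈⟨ Dz≈y ⟨ dmap′ t! α z ∎)
        where
        unpack : dmap′ t? β x ≈ₜ dmap′ t! α z → (Restrict (Unset α) ∘ Restrict (Unset β)) x z
        unpack (m , e? , e! , g) =
            x , (∷-injectiveˡ e! , ≈ₜ-refl x)
          , (trans (g α) (sym (∷-injectiveˡ e?)) , (m , ∷-injectiveʳ e? , ∷-injectiveʳ e! , g))
      from : (Restrict (Unset α) ∘ Restrict (Unset β)) x z → (Graph (dmap t! α) ᵒ ∘ Graph (dmap t? β)) x z
      from (y , (fxβ≡[] , (m₁ , e?₁ , e!₁ , g₁)) , (fyα≡[] , (m₂ , e?₂ , e!₂ , g₂))) =
          dmap′ t? β x , (_ , refl , ≈ₜ-refl (dmap′ t? β x))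
        , (_ , refl , ( sym (trans m₁ m₂)
                      , cong₂ _∷_ (trans (sym (g₂ α)) fyα≡[]) (sym (trans e?₁ e?₂))
                      , cong₂ _∷_ (sym fxβ≡[]) (sym (trans e!₁ e!₂))
                      , λ γ → sym (trans (g₁ γ) (g₂ γ))))

mainTheorem1 : (Name : Set) (ι : Name → ℕ) (ι-inj : Injective _≡_ _≡_ ι) →
    let open Tokens Name ι ι-inj in
    (∀ R → InM R → IsPartialInjection R)
    × Σ (InM Id) (λ i → Σ (InM Zero) (λ z →
        IsInverseMonoidWithZero _≈ᴹ_ _·ᴹ_ _⋆ᴹ (Id , i) (Zero , z)))
    × (⟦ p ⟧ ⊥⊥ ⟦ q ⟧)
    × (∀ α → ⟦ u α ⟧ ⊥⊥ ⟦ v α ⟧)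
    × (∀ α → ⟦ e α ⟧ ∘ ⟦ e α ⟧ ≐ ⟦ e α ⟧)
    × (∀ a → a ∈ (r t! ∷ s t! ∷ []) → ∀ b → b ∈ (r t? ∷ s t? ∷ []) →
         Commute ⟦ a ⟧ (⟦ b ⟧ ᵒ))
    × (∀ α β → α ≢ β → ∀ a → a ∈ (u α ∷ v α ∷ e α ∷ []) →
         ∀ b → b ∈ (p ∷ q ∷ r t? ∷ s t? ∷ r t! ∷ s t! ∷
                    d t? β ∷ d t! β ∷ u β ∷ v β ∷ e β ∷ []) →
         Commute ⟦ a ⟧ ⟦ b ⟧ × Commute ⟦ a ⟧ (⟦ b ⟧ ᵒ))
    × (∀ α t t' → t ≢ t' →
         (⟦ d t α ⟧ ᵒ) ∘ ⟦ r t' ⟧ ≐ (⟦ u α ⟧ ∘ (⟦ d t α ⟧ ᵒ)) ∘ (⟦ u α ⟧ ᵒ))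
    × (∀ α t t' → t ≢ t' →
         (⟦ d t α ⟧ ᵒ) ∘ ⟦ s t' ⟧ ≐ (⟦ v α ⟧ ∘ (⟦ d t α ⟧ ᵒ)) ∘ (⟦ v α ⟧ ᵒ))
    × (∀ α β → α ≢ β → (⟦ d t! α ⟧ ᵒ) ∘ ⟦ d t? β ⟧ ≐ ⟦ e α ⟧ ∘ ⟦ e β ⟧)
mainTheorem1 Name ι ι-inj =
    (λ _ → InM⇒isPartialInjection)
  , (Id∈M , Zero∈M , isInverseMonoidWithZero)
  , p⊥⊥q
  , u⊥⊥v
  , e-idempotent
  , rs!-commute-rs?ᵒ
  , uve-commute
  , dᵒ∘pushTop≐pushF∘dᵒ∘pushFᵒ false
  , dᵒ∘pushTop≐pushF∘dᵒ∘pushFᵒ true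
  , (λ α β _ → d!ᵒ∘d?≐e∘e α β)   -- (viii) holds even for α = β
  where open TokenMachine Name ι ι-inj
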